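{- Let $t\geq 2$ and $k\geq 2$ be integers with $k$ even and $k\leq t$. Let $m_{1}, \dots, m_{k}$ be even integers larger than one and $m_{k+1}, \dots, m_{t}$ be odd integers larger than one. Then $$r_{*}(K_{1, m_{1}}, \dots, K_{1, m_{t}})= \sum_{i= 1}^{t} m_{i}- t+ 1- \frac{k}{2}.$$
   Context: $K_{1,n}$ denotes the star with $n$ edges (on $n+1$ vertices) and $K_N$ the complete graph on $N$ vertices. For graphs $H, H_1,\dots,H_t$, write $H\rightarrow (H_{1}, \dots, H_{t})$ if every coloring of $E(H)$ with colors $1,\dots,t$ yields, for some $i\in[t]$, a copy of $H_i$ (as a subgraph) all of whose edges have color $i$. The Ramsey number $r(H_{1}, \dots, H_{t})$ is the minimum integer $N$ such that $K_{N}\rightarrow (H_{1}, \dots, H_{t})$. For a graph $G$ and subgraph $H$, $G-H$ is the graph with vertex set $V(G)$ and edge set $E(G)\setminus E(H)$ for a copy of $H$ in $G$; thus $K_N - K_{1,N-1-j}$ is $K_{N-1}$ together with one extra vertex joined to exactly $j$ of its vertices. The star-critical Ramsey number $r_{*}(H_{1}, \dots, H_{t})$ is the minimum integer $j$ such that $K_{N}- K_{1, N- 1- j}\rightarrow (H_{1}, \dots, H_{t})$, where $N= r(H_{1}, \dots, H_{t})$. -}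

module Defs where

open import Data.Nat using (ℕ; zero; suc; _+_; _≤_; _<_)
open import Data.Fin using (Fin; zero; suc; toℕ)
open import Data.Product using (Σ; _×_; ∃; proj₁)
open import Data.Empty using (⊥)
open import Data.Unit using (⊤)
open import Relation.Binary.PropositionalEquality using (_≡_; _≢_)
open import Function.Definitions using (Injective)

record Graph : Set₁ where
  field
    size : ℕ
    adj  : Fin size → Fin size → Set

open Graph public

K : ℕ → Graph
K N = record { size = N ; adj = λ x y → x ≢ y }

starAdj : (m : ℕ) → Fin (suc m) → Fin (suc m) → Set
starAdj m zero    zero    = ⊥
starAdj m zero    (suc _) = ⊤
starAdj m (suc _) zero    = ⊤
starAdj m (suc _) (suc _) = ⊥

Star : ℕ → Graph
Star m = record { size = suc m ; adj = starAdj m }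

-- K_N − K_{1,N−1−j} with N = suc n: K_n on vertices suc u plus the extra vertex
-- zero, joined exactly to the j vertices suc u with toℕ u < j (requires j ≤ n).
kmsAdj : (n j : ℕ) → Fin (suc n) → Fin (suc n) → Set
kmsAdj n j zero    zero    = ⊥
kmsAdj n j zero    (suc u) = toℕ u < j
kmsAdj n j (suc u) zero    = toℕ u < j
kmsAdj n j (suc u) (suc w) = u ≢ w

KminusStar : (n j : ℕ) → Graph
KminusStar n j = record { size = suc n ; adj = kmsAdj n j }

-- An edge colouring of G with t colours: a symmetric colour assignment on pairs
-- (values on non-adjacent pairs are irrelevant).
Colouring : Graph → ℕ → Set
Colouring G t = Σ (Fin (size G) → Fin (size G) → Fin t)
                  (λ c → ∀ x y → c x y ≡ c y x)

MonoCopy : (G : Graph) {t : ℕ} → (Fin (size G) → Fin (size G) → Fin t) →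
           Graph → Fin t → Set
MonoCopy G c H i =
  Σ (Fin (size H) → Fin (size G)) λ φ →
    Injective _≡_ _≡_ φ ×
    (∀ x y → adj H x y → adj G (φ x) (φ y) × c (φ x) (φ y) ≡ i)

Arrows : Graph → (t : ℕ) → (Fin t → Graph) → Set
Arrows G t H = (col : Colouring G t) →
  ∃ λ (i : Fin t) → MonoCopy G (proj₁ col) (H i) i

IsLeast : (ℕ → Set) → ℕ → Set
IsLeast P x = P x × (∀ y → P y → x ≤ y)

IsRamseyNumber : (t : ℕ) → (Fin t → Graph) → ℕ → Set
IsRamseyNumber t H = IsLeast (λ N → Arrows (K N) t H)

-- r_*(H_1,…,H_t) = s, where r(H_1,…,H_t) = suc n.
IsStarCritical : (t : ℕ) → (Fin t → Graph) → ℕ → ℕ → Set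
IsStarCritical t H n = IsLeast (λ j → j ≤ n × Arrows (KminusStar n j) t H)

sumFin : (t : ℕ) → (Fin t → ℕ) → ℕ
sumFin zero    f = 0
sumFin (suc t) f = f zero + sumFin t (λ i → f (suc i))

{-# OPTIONS --safe #-}
module Submission where

-- Let n = Σ (mᵢ − 1); it is even, and exactly k of the mᵢ − 1 are odd.  In a colouring of
-- K_{n+1} − K_{1,n−j} without a colour-i star K_{1,mᵢ} every colour-i degree is at most mᵢ − 1.  The
-- colour-i degree sum is even while (n + 1)(mᵢ − 1) is odd for the k even mᵢ, so counting edge ends
-- gives 2j + k ≤ 2n; hence j = n + 1 − k/2 forces a monochromatic star.  Conversely, colour the edge
-- uw of K_n by the residue u + w mod n, giving colour i exactly mᵢ − 1 residues.  Then the extra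
-- vertex can be joined to u through the residue 2u, which u shares with u + n/2.  Laying out the
-- labels 2o, 2o + 1 of a colour on consecutive residues 2x, 2x + 1 lets both partners use 2x, except
-- on the k/2 even residues carrying the leftover label of an odd mᵢ − 1: n − k/2 neighbours in all.

open import Defs
open import Data.Nat using (ℕ; zero; suc; _+_; _*_; _∸_; _≤_; _<_; _<?_; z≤n; s≤s; s≤s⁻¹; ⌊_/2⌋)
open import Data.Nat.Properties
open import Data.Nat.Divisibility using (_∣_; divides; ∣m∣n⇒∣m+n; ∣m+n∣m⇒∣n; ∣1⇒≡1)
open import Data.Nat.DivMod using (_/_; _%_; m*n/n≡m; m≡m%n+[m/n]*n; m%n<n; m<n*o⇒m/o<n; m*n%n≡0)
open import Data.Nat.Primality using (prime?; euclidsLemma)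
open import Data.Nat.Tactic.RingSolver using (solve-∀)
open import Algebra.Properties.CommutativeSemigroup +-commutativeSemigroup using (interchange; x∙yz≈y∙xz; x∙yz≈yx∙z; xy∙z≈xz∙y)
open import Data.Bool using (true; false)
open import Data.Fin as Fin using (Fin; zero; suc; toℕ; fromℕ<; inject≤)
import Data.Fin.Properties as Finₚ
open import Data.Product using (Σ; Σ-syntax; ∃; _×_; _,_; proj₁; proj₂; map₁)
open import Data.Sum using (_⊎_; inj₁; inj₂)
open import Data.Empty using (⊥-elim)
open import Relation.Nullary using (¬_; Dec; yes; no; does; contradiction)
open import Relation.Nullary.Decidable using (_×-dec_; ¬?; from-yes)
open import Relation.Binary.PropositionalEquality
open import Function.Definitions using (Injective)

sumFin-cong : ∀ t {f g : Fin t → ℕ} → (∀ i → f i ≡ g i) → sumFin t f ≡ sumFin t g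
sumFin-cong zero    f≗g = refl
sumFin-cong (suc t) f≗g = cong₂ _+_ (f≗g zero) (sumFin-cong t (λ i → f≗g (suc i)))

sumFin-const : ∀ t c → sumFin t (λ _ → c) ≡ t * c
sumFin-const zero    c = refl
sumFin-const (suc t) c = cong (c +_) (sumFin-const t c)

sumFin-zero : ∀ t → sumFin t (λ _ → 0) ≡ 0
sumFin-zero t = trans (sumFin-const t 0) (*-zeroʳ t)

sumFin-distrib-+ : ∀ t (f g : Fin t → ℕ) →
                   sumFin t (λ i → f i + g i) ≡ sumFin t f + sumFin t g
sumFin-distrib-+ zero    f g = refl
sumFin-distrib-+ (suc t) f g = begin
  f zero + g zero + sumFin t (λ i → f (suc i) + g (suc i))
    ≡⟨ cong (f zero + g zero +_) (sumFin-distrib-+ t (λ i → f (suc i)) (λ i → g (suc i))) ⟩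
  f zero + g zero + (sumFin t (λ i → f (suc i)) + sumFin t (λ i → g (suc i)))
    ≡⟨ interchange (f zero) (g zero) _ _ ⟩
  f zero + sumFin t (λ i → f (suc i)) + (g zero + sumFin t (λ i → g (suc i))) ∎
  where open ≡-Reasoning

*-distribˡ-sumFin : ∀ t c (f : Fin t → ℕ) → c * sumFin t f ≡ sumFin t (λ i → c * f i)
*-distribˡ-sumFin zero    c f = *-zeroʳ c
*-distribˡ-sumFin (suc t) c f =
  trans (*-distribˡ-+ c (f zero) _) (cong (c * f zero +_) (*-distribˡ-sumFin t c (λ i → f (suc i))))

sumFin-mono-≤ : ∀ t {f g : Fin t → ℕ} → (∀ i → f i ≤ g i) → sumFin t f ≤ sumFin t g
sumFin-mono-≤ zero    f≤g = z≤n
sumFin-mono-≤ (suc t) f≤g = +-mono-≤ (f≤g zero) (sumFin-mono-≤ t (λ i → f≤g (suc i)))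

sumFin-swap : ∀ a b (f : Fin a → Fin b → ℕ) →
              sumFin a (λ x → sumFin b (f x)) ≡ sumFin b (λ y → sumFin a (λ x → f x y))
sumFin-swap zero    b f = sym (sumFin-zero b)
sumFin-swap (suc a) b f =
  trans (cong (sumFin b (f zero) +_) (sumFin-swap a b (λ x → f (suc x))))
        (sym (sumFin-distrib-+ b (f zero) (λ y → sumFin a (λ x → f (suc x) y))))

sumFin-pred : ∀ t (m : Fin t → ℕ) → (∀ i → 0 < m i) → sumFin t m ≡ t + sumFin t (λ i → m i ∸ 1)
sumFin-pred zero    m 0<m = refl
sumFin-pred (suc t) m 0<m = begin
  m zero + sumFin t (λ i → m (suc i))                 ≡⟨ cong₂ _+_ (sym (m+[n∸m]≡n (0<m zero))) (sumFin-pred t (λ i → m (suc i)) (λ i → 0<m (suc i))) ⟩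
  1 + (m zero ∸ 1) + (t + sumFin t (λ i → m (suc i) ∸ 1)) ≡⟨ cong suc (x∙yz≈y∙xz (m zero ∸ 1) t _) ⟩
  suc t + sumFin (suc t) (λ i → m i ∸ 1)              ∎
  where open ≡-Reasoning

-- Defined through `does` only, so that 𝟙 (yes a ×-dec b?) reduces to 𝟙 b?.
𝟙 : ∀ {a} {A : Set a} → Dec A → ℕ
𝟙 a? with does a?
... | true  = 1
... | false = 0

𝟙-yes : ∀ {a} {A : Set a} (a? : Dec A) → A → 𝟙 a? ≡ 1
𝟙-yes (yes _) _ = refl
𝟙-yes (no ¬a) a = contradiction a ¬a

𝟙-no : ∀ {a} {A : Set a} (a? : Dec A) → ¬ A → 𝟙 a? ≡ 0
𝟙-no (yes a) ¬a = contradiction a ¬a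
𝟙-no (no _)  _  = refl

𝟙-cong : ∀ {a b} {A : Set a} {B : Set b} → (A → B) → (B → A) →
         (a? : Dec A) (b? : Dec B) → 𝟙 a? ≡ 𝟙 b?
𝟙-cong A→B B→A (yes a) b? = sym (𝟙-yes b? (A→B a))
𝟙-cong A→B B→A (no ¬a) b? = sym (𝟙-no b? (λ b → ¬a (B→A b)))

𝟙-¬?+𝟙 : ∀ {a} {A : Set a} (a? : Dec A) → 𝟙 (¬? a?) + 𝟙 a? ≡ 1
𝟙-¬?+𝟙 (yes _) = refl
𝟙-¬?+𝟙 (no _)  = refl

count-≡ : ∀ t (c : Fin t) → sumFin t (λ i → 𝟙 (c Fin.≟ i)) ≡ 1
count-≡ (suc t) zero    =
  cong suc (trans (sumFin-cong t (λ i → 𝟙-no (zero Fin.≟ suc i) (λ ()))) (sumFin-zero t))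
count-≡ (suc t) (suc c) =
  trans (sumFin-cong t (λ i → 𝟙-cong Finₚ.suc-injective (cong suc) (suc c Fin.≟ suc i) (c Fin.≟ i)))
        (count-≡ t c)

count-≢ : ∀ n (u : Fin n) → sumFin n (λ w → 𝟙 (¬? (u Fin.≟ w))) + 1 ≡ n
count-≢ n u = begin
  sumFin n (λ w → 𝟙 (¬? (u Fin.≟ w))) + 1
    ≡⟨ cong (sumFin n (λ w → 𝟙 (¬? (u Fin.≟ w))) +_) (sym (count-≡ n u)) ⟩
  sumFin n (λ w → 𝟙 (¬? (u Fin.≟ w))) + sumFin n (λ w → 𝟙 (u Fin.≟ w))
    ≡⟨ sym (sumFin-distrib-+ n _ _) ⟩
  sumFin n (λ w → 𝟙 (¬? (u Fin.≟ w)) + 𝟙 (u Fin.≟ w))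
    ≡⟨ sumFin-cong n (λ w → 𝟙-¬?+𝟙 (u Fin.≟ w)) ⟩
  sumFin n (λ _ → 1)
    ≡⟨ trans (sumFin-const n 1) (*-identityʳ n) ⟩
  n ∎
  where open ≡-Reasoning

count-× : ∀ t {a} {A : Set a} (a? : Dec A) (c : Fin t) →
          sumFin t (λ i → 𝟙 (a? ×-dec (c Fin.≟ i))) ≡ 𝟙 a?
count-× t (yes _) c = count-≡ t c
count-× t (no _)  c = sumFin-zero t

count-< : ∀ t k → k ≤ t → sumFin t (λ i → 𝟙 (toℕ i <? k)) ≡ k
count-< zero    zero    z≤n       = refl
count-< (suc t) zero    _         = sumFin-zero t
count-< (suc t) (suc k) (s≤s k≤t) = cong suc (trans
  (sumFin-cong t (λ i → 𝟙-cong s≤s⁻¹ s≤s (toℕ (suc i) <? suc k) (toℕ i <? k)))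
  (count-< t k k≤t))

double≡*2 : ∀ a → a + a ≡ a * 2
double≡*2 = solve-∀

2∣double : ∀ a → 2 ∣ a + a
2∣double a = divides a (double≡*2 a)

2∤suc-double : ∀ a → ¬ 2 ∣ suc (a + a)
2∤suc-double a 2∣a+a+1 = contradiction (∣1⇒≡1 2∣1) (λ ())
  where
  2∣1 : 2 ∣ 1
  2∣1 = ∣m+n∣m⇒∣n (subst (2 ∣_) (+-comm 1 (a + a)) 2∣a+a+1) (2∣double a)

2∤suc : ∀ {n} → 2 ∣ n → ¬ 2 ∣ suc n
2∤suc {n} (divides a n≡a*2) = subst (λ x → ¬ 2 ∣ suc x) (sym (trans n≡a*2 (sym (double≡*2 a)))) (2∤suc-double a)

2∤* : ∀ {a b} → ¬ 2 ∣ a → ¬ 2 ∣ b → ¬ 2 ∣ a * b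
2∤* {a} {b} 2∤a 2∤b 2∣ab with euclidsLemma a b (from-yes (prime? 2)) 2∣ab
... | inj₁ 2∣a = 2∤a 2∣a
... | inj₂ 2∣b = 2∤b 2∣b

even≤odd⇒< : ∀ {a b} → 2 ∣ a → ¬ 2 ∣ b → a ≤ b → a < b
even≤odd⇒< 2∣a 2∤b a≤b with m≤n⇒m<n∨m≡n a≤b
... | inj₁ a<b = a<b
... | inj₂ refl = contradiction 2∣a 2∤b

double-injective : ∀ {o o′} → o + o ≡ o′ + o′ → o ≡ o′
double-injective {o} {o′} eq = begin
  o             ≡⟨ n≡⌊n+n/2⌋ o ⟩
  ⌊ o + o /2⌋   ≡⟨ cong ⌊_/2⌋ eq ⟩
  ⌊ o′ + o′ /2⌋ ≡⟨ n≡⌊n+n/2⌋ o′ ⟨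
  o′            ∎
  where open ≡-Reasoning

bit+double-injective : ∀ {b b′ o o′} → b ≤ 1 → b′ ≤ 1 →
                       b + (o + o) ≡ b′ + (o′ + o′) → b ≡ b′ × o ≡ o′
bit+double-injective {0}     {0}     _ _ eq = refl , double-injective eq
bit+double-injective {1}     {1}     _ _ eq = refl , double-injective (suc-injective eq)
bit+double-injective {0}     {1} {o} {o′} _ _ eq = contradiction (subst (2 ∣_) eq (2∣double o)) (2∤suc-double o′)
bit+double-injective {1}     {0} {o} {o′} _ _ eq = contradiction (subst (2 ∣_) (sym eq) (2∣double o′)) (2∤suc-double o)
bit+double-injective {suc (suc _)} (s≤s ()) _ _
bit+double-injective {_} {suc (suc _)} _ (s≤s ()) _

bit+double-< : ∀ {b o h} → b ≤ 1 → o < h → b + (o + o) < h + h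
bit+double-< {b} {o} {h} b≤1 o<h = begin-strict
  b + (o + o)     ≤⟨ +-monoˡ-≤ (o + o) b≤1 ⟩
  suc (o + o)     <⟨ s≤s (≤-reflexive (sym (+-suc o o))) ⟩
  suc o + suc o   ≤⟨ +-mono-≤ o<h o<h ⟩
  h + h           ∎
  where open ≤-Reasoning

half-decomposition : ∀ s → s ≡ s % 2 + (s / 2 + s / 2)
half-decomposition s = trans (m≡m%n+[m/n]*n s 2) (cong (s % 2 +_) (sym (double≡*2 (s / 2))))

%2-double : ∀ e → (e + e) % 2 ≡ 0
%2-double e = trans (cong (_% 2) (double≡*2 e)) (m*n%n≡0 e 2)

pred-%2-even : ∀ {m} → 0 < m → 2 ∣ m → (m ∸ 1) % 2 ≡ 1
pred-%2-even {suc s} _ 2∣m with s % 2 | m%n<n s 2 | half-decomposition s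
... | 0 | _ | s≡ = contradiction (subst (λ x → 2 ∣ suc x) s≡ 2∣m) (2∤suc-double (s / 2))
... | 1 | _ | _  = refl
... | suc (suc _) | s≤s (s≤s ()) | _

pred-%2-odd : ∀ {m} → 0 < m → ¬ 2 ∣ m → (m ∸ 1) % 2 ≡ 0
pred-%2-odd {suc s} _ 2∤m with s % 2 | m%n<n s 2 | half-decomposition s
... | 0 | _ | _  = refl
... | 1 | _ | s≡ = contradiction (subst (λ x → 2 ∣ suc x) (sym s≡) 2∣2+double) 2∤m
  where
  2∣2+double : 2 ∣ suc (suc (s / 2 + s / 2))
  2∣2+double = subst (2 ∣_) (+-suc (suc (s / 2)) (s / 2)) (2∣double (suc (s / 2)))
... | suc (suc _) | s≤s (s≤s ()) | _

pred≡𝟙+double : ∀ {a} {A : Set a} (a? : Dec A) {m} → 0 < m → (A → 2 ∣ m) → (¬ A → ¬ 2 ∣ m) →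
                m ∸ 1 ≡ 𝟙 a? + ((m ∸ 1) / 2 + (m ∸ 1) / 2)
pred≡𝟙+double (yes a) {m} 0<m even _   =
  trans (half-decomposition (m ∸ 1)) (cong (_+ ((m ∸ 1) / 2 + (m ∸ 1) / 2)) (pred-%2-even 0<m (even a)))
pred≡𝟙+double (no ¬a) {m} 0<m _    odd =
  trans (half-decomposition (m ∸ 1)) (cong (_+ ((m ∸ 1) / 2 + (m ∸ 1) / 2)) (pred-%2-odd 0<m (odd ¬a)))

m∸1<m : ∀ {m} → 0 < m → m ∸ 1 < m
m∸1<m {suc m} _ = n<1+n m

2≤double⇒0< : ∀ {q} → 2 ≤ q + q → 0 < q
2≤double⇒0< {suc q} _ = s≤s z≤n

handshake : ∀ N (A : Fin N → Fin N → ℕ) → (∀ x y → A x y ≡ A y x) → (∀ x → A x x ≡ 0) →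
            2 ∣ sumFin N (λ x → sumFin N (A x))
handshake zero    A A-sym A-diag = divides 0 refl
handshake (suc N) A A-sym A-diag =
  subst (2 ∣_) (sym split) (∣m∣n⇒∣m+n (2∣double R) (handshake N A′ (λ x y → A-sym (suc x) (suc y)) (λ x → A-diag (suc x))))
  where
  open ≡-Reasoning
  A′ : Fin N → Fin N → ℕ
  A′ x y = A (suc x) (suc y)
  R = sumFin N (λ y → A zero (suc y))
  rest = sumFin N (λ x → sumFin N (A′ x))
  split : sumFin (suc N) (λ x → sumFin (suc N) (A x)) ≡ R + R + rest
  split = begin
    A zero zero + R + sumFin N (λ x → A (suc x) zero + sumFin N (A′ x))
      ≡⟨ cong₂ (λ a b → a + R + b) (A-diag zero) (sumFin-distrib-+ N (λ x → A (suc x) zero) (λ x → sumFin N (A′ x))) ⟩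
    R + (sumFin N (λ x → A (suc x) zero) + rest)
      ≡⟨ cong (λ a → R + (a + rest)) (sumFin-cong N (λ x → A-sym (suc x) zero)) ⟩
    R + (R + rest)
      ≡⟨ +-assoc R R rest ⟨
    R + R + rest ∎

≤count⇒injection : ∀ N {p} {P : Fin N → Set p} (P? : ∀ x → Dec (P x)) m →
                   m ≤ sumFin N (λ x → 𝟙 (P? x)) →
                   Σ[ ψ ∈ (Fin m → Fin N) ] Injective _≡_ _≡_ ψ × (∀ r → P (ψ r))
≤count⇒injection N       P? zero    _ = (λ ()) , (λ {x} → λ {}) , λ ()
≤count⇒injection (suc N) {P = P} P? (suc m) m<count with P? zero
... | yes P0 with ≤count⇒injection N (λ x → P? (suc x)) m (s≤s⁻¹ m<count)
...   | ψ , ψ-inj , Pψ = ψ′ , ψ′-inj , Pψ′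
  where
  ψ′ : Fin (suc m) → Fin (suc N)
  ψ′ zero    = zero
  ψ′ (suc r) = suc (ψ r)
  ψ′-inj : Injective _≡_ _≡_ ψ′
  ψ′-inj {zero}  {zero}  _  = refl
  ψ′-inj {suc _} {suc _} eq = cong suc (ψ-inj (Finₚ.suc-injective eq))
  Pψ′ : ∀ r → P (ψ′ r)
  Pψ′ zero    = P0
  Pψ′ (suc r) = Pψ r
≤count⇒injection (suc N) P? (suc m) m<count | no _
  with ≤count⇒injection N (λ x → P? (suc x)) (suc m) m<count
... | ψ , ψ-inj , Pψ = (λ r → suc (ψ r)) , (λ eq → ψ-inj (Finₚ.suc-injective eq)) , Pψ

record _⊆ᴳ_ (G G′ : Graph) : Set where
  field
    embed         : Fin (size G) → Fin (size G′)
    injective     : Injective _≡_ _≡_ embed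
    preserves-adj : ∀ x y → adj G x y → adj G′ (embed x) (embed y)

Arrows-⊆ᴳ : ∀ {G G′} → G ⊆ᴳ G′ → ∀ t H → Arrows G t H → Arrows G′ t H
Arrows-⊆ᴳ {G} {G′} G⊆G′ t H G→H (c , c-sym) =
  let i , φ , φ-inj , φ-mono = G→H ((λ x y → c (embed x) (embed y)) , (λ x y → c-sym (embed x) (embed y)))
  in i , (λ x → embed (φ x)) , (λ eq → φ-inj (injective eq)) ,
     λ x y xy → preserves-adj (φ x) (φ y) (proj₁ (φ-mono x y xy)) , proj₂ (φ-mono x y xy)
  where open _⊆ᴳ_ G⊆G′

monoStar-from-neighbours :
  ∀ (G : Graph) {t} (c : Fin (size G) → Fin (size G) → Fin t) → (∀ x y → c x y ≡ c y x) →
  (∀ x y → adj G x y → adj G y x) → (∀ x → ¬ adj G x x) →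
  ∀ x i m (ψ : Fin m → Fin (size G)) → Injective _≡_ _≡_ ψ →
  (∀ r → adj G x (ψ r) × c x (ψ r) ≡ i) → MonoCopy G c (Star m) i
monoStar-from-neighbours G c c-sym adj-sym adj-irrefl x i m ψ ψ-inj nbr = φ , φ-inj , φ-mono
  where
  φ : Fin (suc m) → Fin (size G)
  φ zero    = x
  φ (suc r) = ψ r
  φ-inj : Injective _≡_ _≡_ φ
  φ-inj {zero}  {zero}   _  = refl
  φ-inj {zero}  {suc r}  eq = ⊥-elim (adj-irrefl x (subst (adj G x) (sym eq) (proj₁ (nbr r))))
  φ-inj {suc r} {zero}   eq = ⊥-elim (adj-irrefl x (subst (adj G x) eq (proj₁ (nbr r))))
  φ-inj {suc _} {suc _}  eq = cong suc (ψ-inj eq)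
  φ-mono : ∀ a b → starAdj m a b → adj G (φ a) (φ b) × c (φ a) (φ b) ≡ i
  φ-mono zero    (suc r) _ = nbr r
  φ-mono (suc r) zero    _ = adj-sym x (ψ r) (proj₁ (nbr r)) , trans (c-sym (ψ r) x) (proj₂ (nbr r))

-- Pigeonhole: the mᵢ leaves of a colour-i star at x would need distinct labels below cap i.
labelled⇒¬monoStar :
  ∀ (G : Graph) {t} (c : Fin (size G) → Fin (size G) → Fin t)
  (label : Fin (size G) → Fin (size G) → ℕ) (cap : Fin t → ℕ) →
  (∀ x y → adj G x y → label x y < cap (c x y)) →
  (∀ x y y′ → adj G x y → adj G x y′ → c x y ≡ c x y′ → label x y ≡ label x y′ → y ≡ y′) →
  ∀ i {mᵢ} → cap i < mᵢ → ¬ MonoCopy G c (Star mᵢ) i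
labelled⇒¬monoStar G c label cap label<cap label-inj i {mᵢ} capᵢ<mᵢ (φ , φ-inj , φ-mono) =
  let r , r′ , r<r′ , code≡ = Finₚ.pigeonhole capᵢ<mᵢ code
  in <-irrefl (cong toℕ (Finₚ.suc-injective (φ-inj (leaf-injective r r′ (decode code≡))))) r<r′
  where
  x = φ zero
  leaf : ∀ r → adj G x (φ (suc r)) × c x (φ (suc r)) ≡ i
  leaf r = φ-mono zero (suc r) _
  label<capᵢ : ∀ r → label x (φ (suc r)) < cap i
  label<capᵢ r = subst (λ j → label x (φ (suc r)) < cap j) (proj₂ (leaf r)) (label<cap x _ (proj₁ (leaf r)))
  code : Fin mᵢ → Fin (cap i)
  code r = fromℕ< (label<capᵢ r)
  decode : ∀ {r r′} → code r ≡ code r′ → label x (φ (suc r)) ≡ label x (φ (suc r′))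
  decode {r} {r′} code≡ = trans (sym (Finₚ.toℕ-fromℕ< (label<capᵢ r)))
                                (trans (cong toℕ code≡) (Finₚ.toℕ-fromℕ< (label<capᵢ r′)))
  leaf-injective : ∀ r r′ → label x (φ (suc r)) ≡ label x (φ (suc r′)) → φ (suc r) ≡ φ (suc r′)
  leaf-injective r r′ = label-inj x _ _ (proj₁ (leaf r)) (proj₁ (leaf r′)) (trans (proj₂ (leaf r)) (sym (proj₂ (leaf r′))))

kmsAdj-sym : ∀ n j x y → kmsAdj n j x y → kmsAdj n j y x
kmsAdj-sym n j zero    (suc u) u<j = u<j
kmsAdj-sym n j (suc u) zero    u<j = u<j
kmsAdj-sym n j (suc u) (suc w) u≢w = λ w≡u → u≢w (sym w≡u)

kmsAdj-irrefl : ∀ n j x → ¬ kmsAdj n j x x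
kmsAdj-irrefl n j (suc u) u≢u = u≢u refl

kmsAdj? : ∀ n j (x y : Fin (suc n)) → Dec (kmsAdj n j x y)
kmsAdj? n j zero    zero    = no (λ ())
kmsAdj? n j zero    (suc u) = toℕ u <? j
kmsAdj? n j (suc u) zero    = toℕ u <? j
kmsAdj? n j (suc u) (suc w) = ¬? (u Fin.≟ w)

K⊆KminusStar : ∀ {y n} j → y ≤ n → K y ⊆ᴳ KminusStar n j
K⊆KminusStar {y} {n} j y≤n = record
  { embed         = λ x → suc (inject≤ x y≤n)
  ; injective     = λ eq → Finₚ.inject≤-injective y≤n y≤n _ _ (Finₚ.suc-injective eq)
  ; preserves-adj = λ x x′ x≢x′ eq → x≢x′ (Finₚ.inject≤-injective y≤n y≤n x x′ eq)
  }

KminusStar-mono : ∀ n {j j′} → j ≤ j′ → KminusStar n j ⊆ᴳ KminusStar n j′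
KminusStar-mono n {j} {j′} j≤j′ = record
  { embed         = λ x → x
  ; injective     = λ eq → eq
  ; preserves-adj = adj-mono
  }
  where
  adj-mono : ∀ x y → kmsAdj n j x y → kmsAdj n j′ x y
  adj-mono zero    (suc u) u<j = <-≤-trans u<j j≤j′
  adj-mono (suc u) zero    u<j = <-≤-trans u<j j≤j′
  adj-mono (suc u) (suc w) u≢w = u≢w

KminusStar⊆K : ∀ n j → KminusStar n j ⊆ᴳ K (suc n)
KminusStar⊆K n j = record
  { embed         = λ x → x
  ; injective     = λ eq → eq
  ; preserves-adj = λ x y xy x≡y → kmsAdj-irrefl n j x (subst (kmsAdj n j x) (sym x≡y) xy)
  }

-- Every K_y with y ≤ n embeds in K_N − K_{1,N−1−j}, so the single failure at j bounds r from below too.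
threshold⇒starCritical : ∀ {t H} n j → j < n →
  ¬ Arrows (KminusStar n j) t H → Arrows (KminusStar n (suc j)) t H →
  IsRamseyNumber t H (suc n) × IsStarCritical t H n (suc j)
threshold⇒starCritical {t} {H} n j j<n ¬arrows arrows =
  (Arrows-⊆ᴳ (KminusStar⊆K n (suc j)) t H arrows , ramsey-least) , ((j<n , arrows) , critical-least)
  where
  ramsey-least : ∀ y → Arrows (K y) t H → suc n ≤ y
  ramsey-least y arrows-y with suc n ≤? y
  ... | yes n<y = n<y
  ... | no  n≮y = contradiction (Arrows-⊆ᴳ (K⊆KminusStar j (≤-pred (≰⇒> n≮y))) t H arrows-y) ¬arrows
  critical-least : ∀ y → y ≤ n × Arrows (KminusStar n y) t H → suc j ≤ y
  critical-least y (_ , arrows-y) with suc j ≤? y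
  ... | yes j<y = j<y
  ... | no  j≮y = contradiction (Arrows-⊆ᴳ (KminusStar-mono n (≤-pred (≰⇒> j≮y))) t H arrows-y) ¬arrows

degree : ∀ n j → Fin (suc n) → ℕ
degree n j x = sumFin (suc n) (λ y → 𝟙 (kmsAdj? n j x y))

degree-sum : ∀ n j → j ≤ n → sumFin (suc n) (degree n j) + n ≡ j + j + n * n
degree-sum n j j≤n = begin
  degree n j zero + sumFin n (λ u → toℕ<j u + inner u) + n
    ≡⟨ cong₂ (λ a b → a + b + n) (count-< n j j≤n) (sumFin-distrib-+ n toℕ<j inner) ⟩
  j + (sumFin n toℕ<j + sumFin n inner) + n
    ≡⟨ cong (λ a → j + (a + sumFin n inner) + n) (count-< n j j≤n) ⟩
  j + (j + sumFin n inner) + n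
    ≡⟨ trans (cong (_+ n) (sym (+-assoc j j (sumFin n inner)))) (+-assoc (j + j) (sumFin n inner) n) ⟩
  j + j + (sumFin n inner + n)
    ≡⟨ cong (j + j +_) inner-sum ⟩
  j + j + n * n ∎
  where
  open ≡-Reasoning
  toℕ<j : Fin n → ℕ
  toℕ<j u = 𝟙 (toℕ u <? j)
  inner : Fin n → ℕ
  inner u = sumFin n (λ w → 𝟙 (¬? (u Fin.≟ w)))
  inner-sum : sumFin n inner + n ≡ n * n
  inner-sum = begin
    sumFin n inner + n                      ≡⟨ cong (sumFin n inner +_) (sym (trans (sumFin-const n 1) (*-identityʳ n))) ⟩
    sumFin n inner + sumFin n (λ _ → 1)     ≡⟨ sym (sumFin-distrib-+ n inner (λ _ → 1)) ⟩
    sumFin n (λ u → inner u + 1)            ≡⟨ sumFin-cong n (count-≢ n) ⟩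
    sumFin n (λ _ → n)                      ≡⟨ sumFin-const n n ⟩
    n * n                                   ∎

module ColourDegrees {t : ℕ} (n j : ℕ) (c : Fin (suc n) → Fin (suc n) → Fin t) (c-sym : ∀ x y → c x y ≡ c y x) where

  coloured? : ∀ x y i → Dec (kmsAdj n j x y × c x y ≡ i)
  coloured? x y i = kmsAdj? n j x y ×-dec (c x y Fin.≟ i)

  colourDegree : Fin t → Fin (suc n) → ℕ
  colourDegree i x = sumFin (suc n) (λ y → 𝟙 (coloured? x y i))

  colourDegree-sum : ∀ x → sumFin t (λ i → colourDegree i x) ≡ degree n j x
  colourDegree-sum x = trans (sumFin-swap t (suc n) (λ i y → 𝟙 (coloured? x y i)))
                             (sumFin-cong (suc n) (λ y → count-× t (kmsAdj? n j x y) (c x y)))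

  colourDegree-even : ∀ i → 2 ∣ sumFin (suc n) (λ x → colourDegree i x)
  colourDegree-even i = handshake (suc n) (λ x y → 𝟙 (coloured? x y i))
    (λ x y → 𝟙-cong (λ { (xy , cxy) → kmsAdj-sym n j x y xy , trans (c-sym y x) cxy })
                    (λ { (yx , cyx) → kmsAdj-sym n j y x yx , trans (c-sym x y) cyx })
                    (coloured? x y i) (coloured? y x i))
    (λ x → 𝟙-no (coloured? x x i) (λ { (xx , _) → kmsAdj-irrefl n j x xx }))

  colourDegrees : Fin t → ℕ
  colourDegrees i = sumFin (suc n) (λ x → colourDegree i x)

  colourDegrees-≤ : ∀ i b → (∀ x → colourDegree i x ≤ b) → colourDegrees i ≤ suc n * b
  colourDegrees-≤ i b small = ≤-trans (sumFin-mono-≤ (suc n) small) (≤-reflexive (sumFin-const (suc n) b))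

  colourDegrees-<-odd : ∀ i b → (∀ x → colourDegree i x ≤ b) → ¬ 2 ∣ suc n * b → colourDegrees i < suc n * b
  colourDegrees-<-odd i b small odd = even≤odd⇒< (colourDegree-even i) odd (colourDegrees-≤ i b small)

  degrees-bound : ∀ k → k ≤ t → 2 ∣ n → (b : Fin t → ℕ) → (∀ i → toℕ i < k → ¬ 2 ∣ b i) →
                  (∀ i x → colourDegree i x ≤ b i) →
                  sumFin (suc n) (degree n j) + k ≤ suc n * sumFin t b
  degrees-bound k k≤t 2∣n b odd small = begin
    sumFin (suc n) (degree n j) + k
      ≡⟨ cong₂ _+_ (sym total) (sym (count-< t k k≤t)) ⟩
    sumFin t colourDegrees + sumFin t (λ i → 𝟙 (toℕ i <? k))
      ≡⟨ sym (sumFin-distrib-+ t colourDegrees _) ⟩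
    sumFin t (λ i → colourDegrees i + 𝟙 (toℕ i <? k))
      ≤⟨ sumFin-mono-≤ t (λ i → per-colour i (toℕ i <? k)) ⟩
    sumFin t (λ i → suc n * b i)
      ≡⟨ sym (*-distribˡ-sumFin t (suc n) b) ⟩
    suc n * sumFin t b ∎
    where
    open ≤-Reasoning
    total : sumFin t colourDegrees ≡ sumFin (suc n) (degree n j)
    total = trans (sumFin-swap t (suc n) colourDegree) (sumFin-cong (suc n) colourDegree-sum)
    per-colour : ∀ i (i<k? : Dec (toℕ i < k)) → colourDegrees i + 𝟙 i<k? ≤ suc n * b i
    per-colour i (yes i<k) = subst (_≤ suc n * b i) (+-comm 1 _)
      (colourDegrees-<-odd i (b i) (small i) (2∤* (2∤suc 2∣n) (odd i i<k)))
    per-colour i (no  _)   = subst (_≤ suc n * b i) (sym (+-identityʳ _)) (colourDegrees-≤ i (b i) (small i))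

  monoStar-or-bounded : (m : Fin t → ℕ) →
    (∃ λ i → MonoCopy (KminusStar n j) c (Star (m i)) i) ⊎ (∀ i x → colourDegree i x ≤ m i ∸ 1)
  monoStar-or-bounded m with Finₚ.any? (λ x → Finₚ.any? (λ i → m i ≤? colourDegree i x))
  ... | yes (x , i , mᵢ≤deg) =
    let ψ , ψ-inj , nbr = ≤count⇒injection (suc n) (λ y → coloured? x y i) (m i) mᵢ≤deg
    in inj₁ (i , monoStar-from-neighbours (KminusStar n j) c c-sym (kmsAdj-sym n j) (kmsAdj-irrefl n j) x i (m i) ψ ψ-inj nbr)
  ... | no noCentre = inj₂ bounded
    where
    bounded : ∀ i x → colourDegree i x ≤ m i ∸ 1
    bounded i x with m i ≤? colourDegree i x
    ... | yes mᵢ≤deg = contradiction (x , i , mᵢ≤deg) noCentre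
    ... | no  mᵢ≰deg = subst (colourDegree i x ≤_) (pred[m∸n]≡m∸[1+n] (m i) 0) (suc[m]≤n⇒m≤pred[n] (≰⇒> mᵢ≰deg))

  -- Counting edge ends twice: 2j + n(n − 1) = Σ degrees ≤ (n + 1) Σ bᵢ − k ≤ (n + 1) n − k.
  bounded⇒j+j+k≤n+n : ∀ k → k ≤ t → j ≤ n → 2 ∣ n → (b : Fin t → ℕ) → sumFin t b ≤ n →
                      (∀ i → toℕ i < k → ¬ 2 ∣ b i) → (∀ i x → colourDegree i x ≤ b i) → j + j + k ≤ n + n
  bounded⇒j+j+k≤n+n k k≤t j≤n 2∣n b Σb≤n odd bounded = +-cancelˡ-≤ (n * n) _ _ (begin
    n * n + (j + j + k)                  ≡⟨ x∙yz≈yx∙z (n * n) (j + j) k ⟩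
    j + j + n * n + k                    ≡⟨ cong (_+ k) (degree-sum n j j≤n) ⟨
    sumFin (suc n) (degree n j) + n + k  ≡⟨ xy∙z≈xz∙y _ n k ⟩
    sumFin (suc n) (degree n j) + k + n  ≤⟨ +-monoˡ-≤ n (degrees-bound k k≤t 2∣n b odd bounded) ⟩
    suc n * sumFin t b + n               ≤⟨ +-monoˡ-≤ n (*-monoʳ-≤ (suc n) Σb≤n) ⟩
    suc n * n + n                        ≡⟨ square-identity n ⟩
    n * n + (n + n)                      ∎)
    where
    open ≤-Reasoning
    square-identity : ∀ a → suc a * a + a ≡ a * a + (a + a)
    square-identity = solve-∀

KminusStar→stars : ∀ t (m : Fin t → ℕ) k n j → k ≤ t → j ≤ n → 2 ∣ n →
  sumFin t (λ i → m i ∸ 1) ≤ n → (∀ i → toℕ i < k → ¬ 2 ∣ m i ∸ 1) →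
  n + n < j + j + k → Arrows (KminusStar n j) t (λ i → Star (m i))
KminusStar→stars t m k n j k≤t j≤n 2∣n Σ≤n odd n+n<j+j+k (c , c-sym)
  with ColourDegrees.monoStar-or-bounded n j c c-sym m
... | inj₁ star    = star
... | inj₂ bounded = contradiction
  (ColourDegrees.bounded⇒j+j+k≤n+n n j c c-sym k k≤t j≤n 2∣n (λ i → m i ∸ 1) Σ≤n odd bounded) (<⇒≱ n+n<j+j+k)

blockStart : ∀ {t} → (Fin t → ℕ) → Fin t → ℕ
blockStart b zero    = 0
blockStart b (suc i) = b zero + blockStart (λ j → b (suc j)) i

-- Block index and offset of c among consecutive blocks of sizes b 0, b 1, … (past the end: the last block).
locate : ∀ t → (Fin (suc t) → ℕ) → ℕ → Fin (suc t) × ℕ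
locate zero    b c = zero , c
locate (suc t) b c with c <? b zero
... | yes _ = zero , c
... | no  _ = map₁ suc (locate t (λ i → b (suc i)) (c ∸ b zero))

locate-spec : ∀ t (b : Fin (suc t) → ℕ) c → c < sumFin (suc t) b →
              proj₂ (locate t b c) < b (proj₁ (locate t b c)) ×
              c ≡ blockStart b (proj₁ (locate t b c)) + proj₂ (locate t b c)
locate-spec zero    b c c<Σ = subst (c <_) (+-identityʳ (b zero)) c<Σ , refl
locate-spec (suc t) b c c<Σ with c <? b zero
... | yes c<b₀ = c<b₀ , refl
... | no  c≮b₀ with locate-spec t (λ i → b (suc i)) (c ∸ b zero) (+-cancelˡ-< (b zero) _ _ c∸b₀<Σ)
  where
  c∸b₀<Σ : b zero + (c ∸ b zero) < b zero + sumFin (suc t) (λ i → b (suc i))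
  c∸b₀<Σ = subst (_< sumFin (suc (suc t)) b) (sym (m+[n∸m]≡n (≮⇒≥ c≮b₀))) c<Σ
...   | o<b , c∸b₀≡ = o<b , trans (sym (m+[n∸m]≡n (≮⇒≥ c≮b₀))) (trans (cong (b zero +_) c∸b₀≡) (sym (+-assoc (b zero) _ _)))

-- Slots 0 … 2H+k−1 (the residues mod n of the construction) receive a colour and a label below
-- the capacity of that colour.  Front slots 2x, 2x+1 share the colour of the block containing x,
-- with labels 2o, 2o+1; back slot 2H+r gets colour r and the top label 2hᵣ.
module SlotLabelling {t1 : ℕ} (h : Fin (suc t1) → ℕ) (k : ℕ) (k≤t : k ≤ suc t1) where

  H : ℕ
  H = sumFin (suc t1) h

  capacity : Fin (suc t1) → ℕ
  capacity i = 𝟙 (toℕ i <? k) + (h i + h i)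

  backColour : ℕ → Fin (suc t1)
  backColour r = fromℕ< (s≤s (m⊓n≤n r t1))

  slot′ : (s : ℕ) → Dec (s < H + H) → Fin (suc t1) × ℕ
  slot′ s (yes _) = let i , o = locate t1 h (s / 2) in i , s % 2 + (o + o)
  slot′ s (no  _) = let i = backColour (s ∸ (H + H)) in i , h i + h i

  slotColour : ℕ → Fin (suc t1)
  slotColour s = proj₁ (slot′ s (s <? H + H))

  slotLabel : ℕ → ℕ
  slotLabel s = proj₂ (slot′ s (s <? H + H))

  front-slot : ∀ s → s < H + H → Σ[ o ∈ ℕ ] slotLabel s ≡ s % 2 + (o + o) × o < h (slotColour s) ×
                                             s / 2 ≡ blockStart h (slotColour s) + o
  front-slot s s<2H with s <? H + H
  ... | yes _   = proj₂ (locate t1 h (s / 2)) , refl , locate-spec t1 h (s / 2) (m<n*o⇒m/o<n (subst (s <_) (double≡*2 H) s<2H))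
  ... | no  s≮2H = contradiction s<2H s≮2H

  back-slot : ∀ s → ¬ s < H + H → s < H + H + k →
              toℕ (slotColour s) ≡ s ∸ (H + H) × s ∸ (H + H) < k ×
              slotLabel s ≡ h (slotColour s) + h (slotColour s)
  back-slot s s≮2H s<2H+k with s <? H + H
  ... | yes s<2H = contradiction s<2H s≮2H
  ... | no  _    = trans (Finₚ.toℕ-fromℕ< _) (m≤n⇒m⊓n≡m (s≤s⁻¹ (≤-trans r<k k≤t))) , r<k , refl
    where
    r<k : s ∸ (H + H) < k
    r<k = +-cancelˡ-< (H + H) _ _ (subst (_< H + H + k) (sym (m+[n∸m]≡n (≮⇒≥ s≮2H))) s<2H+k)

  front-label< : ∀ s → s < H + H → slotLabel s < h (slotColour s) + h (slotColour s)
  front-label< s s<2H with front-slot s s<2H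
  ... | o , lbl≡ , o<h , _ = subst (_< h (slotColour s) + h (slotColour s)) (sym lbl≡) (bit+double-< (s≤s⁻¹ (m%n<n s 2)) o<h)

  slotLabel<capacity : ∀ s → s < H + H + k → slotLabel s < capacity (slotColour s)
  slotLabel<capacity s s<n = go (s <? H + H)
    where
    i = slotColour s
    go : Dec (s < H + H) → slotLabel s < capacity i
    go (yes s<2H) = ≤-trans (front-label< s s<2H) (m≤n+m (h i + h i) (𝟙 (toℕ i <? k)))
    go (no  s≮2H) with back-slot s s≮2H s<n
    ... | toℕ≡ , r<k , lbl≡ =
      subst₂ _<_ (sym lbl≡) (cong (_+ (h i + h i)) (sym (𝟙-yes (toℕ i <? k) (subst (_< k) (sym toℕ≡) r<k)))) ≤-refl

  slot-injective : ∀ s s′ → s < H + H + k → s′ < H + H + k →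
                   slotColour s ≡ slotColour s′ → slotLabel s ≡ slotLabel s′ → s ≡ s′
  slot-injective s s′ s<n s′<n colour≡ label≡ = go (s <? H + H) (s′ <? H + H)
    where
    open ≡-Reasoning
    ≮-front-back : ∀ {a b} → slotLabel a ≡ slotLabel b → slotColour a ≡ slotColour b → ¬ b < H + H → b < H + H + k →
                   ¬ slotLabel a < h (slotColour a) + h (slotColour a)
    ≮-front-back {a} {b} label≡ colour≡ b≮2H b<n =
      <-irrefl (trans label≡ (trans (proj₂ (proj₂ (back-slot b b≮2H b<n))) (cong (λ i → h i + h i) (sym colour≡))))

    go : Dec (s < H + H) → Dec (s′ < H + H) → s ≡ s′
    go (yes s<2H) (yes s′<2H) with front-slot s s<2H | front-slot s′ s′<2H
    ... | o , lbl≡ , _ , s/2≡ | o′ , lbl≡′ , _ , s′/2≡ with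
          bit+double-injective (s≤s⁻¹ (m%n<n s 2)) (s≤s⁻¹ (m%n<n s′ 2)) (trans (sym lbl≡) (trans label≡ lbl≡′))
    ...   | bit≡ , o≡o′ = begin
      s                         ≡⟨ half-decomposition s ⟩
      s % 2 + (s / 2 + s / 2)   ≡⟨ cong₂ (λ b x → b + (x + x)) bit≡ half≡ ⟩
      s′ % 2 + (s′ / 2 + s′ / 2) ≡⟨ half-decomposition s′ ⟨
      s′                        ∎
      where
      half≡ : s / 2 ≡ s′ / 2
      half≡ = trans s/2≡ (trans (cong₂ _+_ (cong (blockStart h) colour≡) o≡o′) (sym s′/2≡))
    go (no s≮2H) (no s′≮2H) with back-slot s s≮2H s<n | back-slot s′ s′≮2H s′<n
    ... | toℕ≡ , _ , _ | toℕ≡′ , _ , _ = begin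
      s                         ≡⟨ m+[n∸m]≡n (≮⇒≥ s≮2H) ⟨
      H + H + (s ∸ (H + H))     ≡⟨ cong (H + H +_) (trans (sym toℕ≡) (trans (cong toℕ colour≡) toℕ≡′)) ⟩
      H + H + (s′ ∸ (H + H))    ≡⟨ m+[n∸m]≡n (≮⇒≥ s′≮2H) ⟩
      s′                        ∎
    go (yes s<2H) (no s′≮2H) = contradiction (front-label< s s<2H) (≮-front-back label≡ colour≡ s′≮2H s′<n)
    go (no s≮2H) (yes s′<2H) = contradiction (front-label< s′ s′<2H) (≮-front-back (sym label≡) (sym colour≡) s≮2H s<n)

  slotLabel-double : ∀ e → e + e < H + H + k → Σ[ o ∈ ℕ ] slotLabel (e + e) ≡ o + o
  slotLabel-double e e+e<n = go (e + e <? H + H)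
    where
    go : Dec (e + e < H + H) → Σ[ o ∈ ℕ ] slotLabel (e + e) ≡ o + o
    go (yes front) with front-slot (e + e) front
    ... | o , lbl≡ , _ = o , trans lbl≡ (cong (_+ (o + o)) (%2-double e))
    go (no  back)  = h (slotColour (e + e)) , proj₂ (proj₂ (back-slot (e + e) back e+e<n))

  -- The odd label just above an even front label is free for the second vertex sharing that slot.
  slotLabel-double-room : ∀ e → e < H → suc (slotLabel (e + e)) < capacity (slotColour (e + e))
  slotLabel-double-room e e<H with front-slot (e + e) (+-mono-< e<H e<H)
  ... | o , lbl≡ , o<h , _ = ≤-trans (subst (λ l → suc l < h i + h i) (sym (trans lbl≡ (cong (_+ (o + o)) (%2-double e))))
                                              (bit+double-< (s≤s z≤n) o<h)) (m≤n+m (h i + h i) (𝟙 (toℕ i <? k)))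
    where i = slotColour (e + e)

-- Colouring of K_n, n = 2p, on ℤ_n: the edge uw gets the slot u + w mod n, so the n − 1 edges at u
-- together with the unused slot 2u take every slot exactly once.  The extra vertex is joined to each
-- u < p + H through the slot 2u; since 2u ≡ 2(u − p) for u ≥ p, those u take the label just above.
module SumColouring {t : ℕ} (p H : ℕ) (H≤p : H ≤ p)
  (col : ℕ → Fin t) (lbl : ℕ → ℕ) (cap : Fin t → ℕ)
  (lbl<cap : ∀ s → s < p + p → lbl s < cap (col s))
  (slot-injective : ∀ s s′ → s < p + p → s′ < p + p → col s ≡ col s′ → lbl s ≡ lbl s′ → s ≡ s′)
  (lbl-double : ∀ e → e + e < p + p → Σ[ o ∈ ℕ ] lbl (e + e) ≡ o + o)
  (lbl-double-room : ∀ e → e < H → suc (lbl (e + e)) < cap (col (e + e)))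
  where

  n j : ℕ
  n = p + p
  j = p + H

  reduce : ℕ → ℕ
  reduce x with x <? n
  ... | yes _ = x
  ... | no  _ = x ∸ n

  reduce-< : ∀ {x} → x < n → reduce x ≡ x
  reduce-< {x} x<n with x <? n
  ... | yes _   = refl
  ... | no  x≮n = contradiction x<n x≮n

  reduce-≥ : ∀ {x} → ¬ x < n → n + reduce x ≡ x
  reduce-≥ {x} x≮n with x <? n
  ... | yes x<n = contradiction x<n x≮n
  ... | no  _   = m+[n∸m]≡n (≮⇒≥ x≮n)

  reduce<n : ∀ x → x < n + n → reduce x < n
  reduce<n x x<2n with x <? n
  ... | yes x<n = x<n
  ... | no  x≮n = +-cancelˡ-< n _ _ (subst (_< n + n) (sym (m+[n∸m]≡n (≮⇒≥ x≮n))) x<2n)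

  reduce-no-wrap : ∀ a {b b′} → b′ < n → a + b < n → ¬ a + b′ < n → reduce (a + b) ≢ reduce (a + b′)
  reduce-no-wrap a {b} {b′} b′<n l l′ red≡ = <-irrefl refl (begin-strict
    a + b′                <⟨ +-monoʳ-< a b′<n ⟩
    a + n                 ≡⟨ +-comm a n ⟩
    n + a                 ≤⟨ +-monoʳ-≤ n (m≤m+n a b) ⟩
    n + (a + b)           ≡⟨ cong (n +_) (trans (sym (reduce-< l)) red≡) ⟩
    n + reduce (a + b′)   ≡⟨ reduce-≥ l′ ⟩
    a + b′                ∎)
    where open ≤-Reasoning

  reduce-injective : ∀ a {b b′} → b < n → b′ < n → reduce (a + b) ≡ reduce (a + b′) → b ≡ b′
  reduce-injective a {b} {b′} b<n b′<n red≡ = +-cancelˡ-≡ a b b′ (go (a + b <? n) (a + b′ <? n))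
    where
    go : Dec (a + b < n) → Dec (a + b′ < n) → a + b ≡ a + b′
    go (yes l) (yes l′) = trans (sym (reduce-< l)) (trans red≡ (reduce-< l′))
    go (no  l) (no  l′) = trans (sym (reduce-≥ l)) (trans (cong (n +_) red≡) (reduce-≥ l′))
    go (yes l) (no  l′) = contradiction red≡ (reduce-no-wrap a b′<n l l′)
    go (no  l) (yes l′) = contradiction (sym red≡) (reduce-no-wrap a b<n l′ l)

  rem quot : ℕ → ℕ
  rem u with u <? p
  ... | yes _ = u
  ... | no  _ = u ∸ p
  quot u with u <? p
  ... | yes _ = 0
  ... | no  _ = 1

  quot≤1 : ∀ u → quot u ≤ 1
  quot≤1 u with u <? p
  ... | yes _ = z≤n
  ... | no  _ = s≤s z≤n

  quot-rem-injective : ∀ u u′ → quot u ≡ quot u′ → rem u ≡ rem u′ → u ≡ u′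
  quot-rem-injective u u′ quot≡ rem≡ with u <? p | u′ <? p
  ... | yes _   | yes _    = rem≡
  ... | no  u≮p | no  u′≮p = begin
    u             ≡⟨ m+[n∸m]≡n (≮⇒≥ u≮p) ⟨
    p + (u ∸ p)   ≡⟨ cong (p +_) rem≡ ⟩
    p + (u′ ∸ p)  ≡⟨ m+[n∸m]≡n (≮⇒≥ u′≮p) ⟩
    u′            ∎
    where open ≡-Reasoning
  quot-rem-injective u u′ () _ | yes _ | no _
  quot-rem-injective u u′ () _ | no _  | yes _

  reduce-double : ∀ u → u < n → reduce (u + u) ≡ rem u + rem u
  reduce-double u u<n with u <? p
  ... | yes u<p = reduce-< (+-mono-< u<p u<p)
  ... | no  u≮p = +-cancelˡ-≡ n _ _ (begin
    n + reduce (u + u)                ≡⟨ reduce-≥ (λ u+u<n → u≮p (≰⇒> (λ p≤u → <⇒≱ u+u<n (+-mono-≤ p≤u p≤u)))) ⟩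
    u + u                             ≡⟨ cong (λ v → v + v) (m+[n∸m]≡n (≮⇒≥ u≮p)) ⟨
    p + (u ∸ p) + (p + (u ∸ p))       ≡⟨ interchange p (u ∸ p) p (u ∸ p) ⟩
    n + ((u ∸ p) + (u ∸ p))           ∎)
    where open ≡-Reasoning

  reduce-double<n : ∀ u → u < n → reduce (u + u) < n
  reduce-double<n u u<n = reduce<n (u + u) (+-mono-< u<n u<n)

  double-label : ∀ u → u < n → Σ[ o ∈ ℕ ] lbl (reduce (u + u)) ≡ o + o
  double-label u u<n with lbl-double (rem u) (subst (_< n) (reduce-double u u<n) (reduce-double<n u u<n))
  ... | o , lbl≡ = o , trans (cong lbl (reduce-double u u<n)) lbl≡

  <j⇒<n : ∀ {u} → u < j → u < n
  <j⇒<n u<j = <-≤-trans u<j (+-monoʳ-≤ p H≤p)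

  extra-label<cap : ∀ u → u < j → lbl (reduce (u + u)) + quot u < cap (col (reduce (u + u)))
  extra-label<cap u u<j rewrite reduce-double u (<j⇒<n u<j) with u <? p
  ... | yes u<p = subst (_< cap (col (u + u))) (sym (+-identityʳ _)) (lbl<cap (u + u) (+-mono-< u<p u<p))
  ... | no  u≮p = subst (_< cap (col (r + r))) (+-comm 1 _) (lbl-double-room r r<H)
    where
    r = u ∸ p
    r<H : r < H
    r<H = +-cancelˡ-< p _ _ (subst (_< j) (sym (m+[n∸m]≡n (≮⇒≥ u≮p))) u<j)

  extra-injective : ∀ u u′ → u < j → u′ < j → col (reduce (u + u)) ≡ col (reduce (u′ + u′)) →
                    lbl (reduce (u + u)) + quot u ≡ lbl (reduce (u′ + u′)) + quot u′ → u ≡ u′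
  extra-injective u u′ u<j u′<j col≡ label≡ with double-label u (<j⇒<n u<j) | double-label u′ (<j⇒<n u′<j)
  ... | o , lbl≡ | o′ , lbl≡′ = quot-rem-injective u u′ (proj₁ bits) (double-injective rem+rem≡)
    where
    bits : quot u ≡ quot u′ × o ≡ o′
    bits = bit+double-injective {o = o} {o′ = o′} (quot≤1 u) (quot≤1 u′)
             (trans (+-comm (quot u) _) (trans (cong (_+ quot u) (sym lbl≡))
               (trans label≡ (trans (cong (_+ quot u′) lbl≡′) (+-comm _ (quot u′))))))
    rem+rem≡ : rem u + rem u ≡ rem u′ + rem u′
    rem+rem≡ = trans (sym (reduce-double u (<j⇒<n u<j))) (trans
      (slot-injective _ _ (reduce-double<n u (<j⇒<n u<j)) (reduce-double<n u′ (<j⇒<n u′<j)) col≡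
                          (trans lbl≡ (trans (cong (λ v → v + v) (proj₂ bits)) (sym lbl≡′))))
      (reduce-double u′ (<j⇒<n u′<j)))

  slot : Fin (suc n) → Fin (suc n) → ℕ
  slot zero    zero    = 0
  slot zero    (suc u) = reduce (toℕ u + toℕ u)
  slot (suc u) zero    = reduce (toℕ u + toℕ u)
  slot (suc u) (suc w) = reduce (toℕ u + toℕ w)

  colour : Fin (suc n) → Fin (suc n) → Fin t
  colour x y = col (slot x y)

  colour-sym : ∀ x y → colour x y ≡ colour y x
  colour-sym zero    zero    = refl
  colour-sym zero    (suc u) = refl
  colour-sym (suc u) zero    = refl
  colour-sym (suc u) (suc w) = cong (λ s → col (reduce s)) (+-comm (toℕ u) (toℕ w))

  label : Fin (suc n) → Fin (suc n) → ℕ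
  label zero (suc u) = lbl (slot zero (suc u)) + quot (toℕ u)
  label x    y       = lbl (slot x y)

  -- Seen from the vertex suc u, the extra vertex zero plays the role of u itself.
  partner : Fin n → Fin (suc n) → ℕ
  partner u zero    = toℕ u
  partner u (suc w) = toℕ w

  partner<n : ∀ u y → partner u y < n
  partner<n u zero    = Finₚ.toℕ<n u
  partner<n u (suc w) = Finₚ.toℕ<n w

  slot-partner : ∀ u y → slot (suc u) y ≡ reduce (toℕ u + partner u y)
  slot-partner u zero    = refl
  slot-partner u (suc w) = refl

  slot<n : ∀ u y → slot (suc u) y < n
  slot<n u y = subst (_< n) (sym (slot-partner u y)) (reduce<n _ (+-mono-< (Finₚ.toℕ<n u) (partner<n u y)))

  partner-injective : ∀ u y y′ → kmsAdj n j (suc u) y → kmsAdj n j (suc u) y′ → partner u y ≡ partner u y′ → y ≡ y′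
  partner-injective u zero     zero     _   _    _  = refl
  partner-injective u zero     (suc w′) _   u≢w′ eq = contradiction (Finₚ.toℕ-injective eq) u≢w′
  partner-injective u (suc w)  zero     u≢w _    eq = contradiction (Finₚ.toℕ-injective (sym eq)) u≢w
  partner-injective u (suc w)  (suc w′) _   _    eq = cong suc (Finₚ.toℕ-injective eq)

  label<cap : ∀ x y → kmsAdj n j x y → label x y < cap (colour x y)
  label<cap zero    (suc u) u<j = extra-label<cap (toℕ u) u<j
  label<cap (suc u) y       _   = lbl<cap _ (slot<n u y)

  label-injective : ∀ x y y′ → kmsAdj n j x y → kmsAdj n j x y′ →
                    colour x y ≡ colour x y′ → label x y ≡ label x y′ → y ≡ y′
  label-injective zero    (suc w) (suc w′) w<j w′<j col≡ label≡ =
    cong suc (Finₚ.toℕ-injective (extra-injective (toℕ w) (toℕ w′) w<j w′<j col≡ label≡))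
  label-injective (suc u) y y′ uy uy′ col≡ label≡ =
    partner-injective u y y′ uy uy′ (reduce-injective (toℕ u) (partner<n u y) (partner<n u y′)
      (trans (sym (slot-partner u y)) (trans (slot-injective _ _ (slot<n u y) (slot<n u y′) col≡ label≡) (slot-partner u y′))))

  ↛stars : (m : Fin t → ℕ) → (∀ i → cap i < m i) → ¬ Arrows (KminusStar n j) t (λ i → Star (m i))
  ↛stars m cap<m arrows with arrows (colour , colour-sym)
  ... | i , copy = labelled⇒¬monoStar (KminusStar n j) colour label cap label<cap label-injective i (cap<m i) copy

KminusStar↛stars : ∀ t1 (m h : Fin (suc t1) → ℕ) k q → k ≡ q + q → k ≤ suc t1 →
  (∀ i → 𝟙 (toℕ i <? k) + (h i + h i) < m i) →
  let H = sumFin (suc t1) h in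
  ¬ Arrows (KminusStar (H + q + (H + q)) (H + q + H)) (suc t1) (λ i → Star (m i))
KminusStar↛stars t1 m h k q k≡q+q k≤t cap<m = SC.↛stars m cap<m
  where
  open SlotLabelling h k k≤t
  n≡ : H + q + (H + q) ≡ H + H + k
  n≡ = trans (interchange H q H q) (cong (H + H +_) (sym k≡q+q))
  module SC = SumColouring (H + q) H (m≤m+n H q) slotColour slotLabel capacity
    (λ s s<n → slotLabel<capacity s (subst (s <_) n≡ s<n))
    (λ s s′ s<n s′<n → slot-injective s s′ (subst (s <_) n≡ s<n) (subst (s′ <_) n≡ s′<n))
    (λ e e+e<n → slotLabel-double e (subst (e + e <_) n≡ e+e<n))
    slotLabel-double-room

star-critical-value : ∀ t n q j → n + 1 ≡ q + j → (t + n + 1 ∸ t) ∸ (q * 2) / 2 ≡ j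
star-critical-value t n q j n+1≡ = begin
  (t + n + 1 ∸ t) ∸ (q * 2) / 2 ≡⟨ cong₂ _∸_ (trans (cong (_∸ t) (+-assoc t n 1)) (m+n∸m≡n t (n + 1))) (m*n/n≡m q 2) ⟩
  n + 1 ∸ q                     ≡⟨ cong (_∸ q) n+1≡ ⟩
  q + j ∸ q                     ≡⟨ m+n∸m≡n q j ⟩
  j                             ∎
  where open ≡-Reasoning

sumFin-pred-decomposed : ∀ t (m h : Fin t → ℕ) k q → k ≡ q + q → k ≤ t →
  (∀ i → m i ∸ 1 ≡ 𝟙 (toℕ i <? k) + (h i + h i)) →
  sumFin t (λ i → m i ∸ 1) ≡ sumFin t h + q + (sumFin t h + q)
sumFin-pred-decomposed t m h k q k≡q+q k≤t pred-m = begin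
  sumFin t (λ i → m i ∸ 1)                           ≡⟨ sumFin-cong t pred-m ⟩
  sumFin t (λ i → 𝟙 (toℕ i <? k) + (h i + h i))      ≡⟨ sumFin-distrib-+ t (λ i → 𝟙 (toℕ i <? k)) (λ i → h i + h i) ⟩
  sumFin t (λ i → 𝟙 (toℕ i <? k)) + sumFin t (λ i → h i + h i)
    ≡⟨ cong₂ _+_ (trans (count-< t k k≤t) k≡q+q) (sumFin-distrib-+ t h h) ⟩
  q + q + (H + H)                                    ≡⟨ interchange q q H H ⟩
  q + H + (q + H)                                    ≡⟨ cong (λ x → x + x) (+-comm q H) ⟩
  H + q + (H + q)                                    ∎
  where
  open ≡-Reasoning
  H = sumFin t h

stars-threshold : ∀ t1 (m h : Fin (suc t1) → ℕ) k q → k ≡ q + q → 0 < q → k ≤ suc t1 → (∀ i → 0 < m i) →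
  (∀ i → m i ∸ 1 ≡ 𝟙 (toℕ i <? k) + (h i + h i)) →
  let H = sumFin (suc t1) h ; n = H + q + (H + q) ; j = H + q + H in
  IsRamseyNumber (suc t1) (λ i → Star (m i)) (suc n) × IsStarCritical (suc t1) (λ i → Star (m i)) n (suc j)
stars-threshold t1 m h k q k≡q+q 0<q k≤t 0<m pred-m = threshold⇒starCritical n j j<n
  (KminusStar↛stars t1 m h k q k≡q+q k≤t (λ i → subst (_< m i) (pred-m i) (m∸1<m (0<m i))))
  (KminusStar→stars t m k n (suc j) k≤t j<n (2∣double (H + q))
     (≤-reflexive (sumFin-pred-decomposed t m h k q k≡q+q k≤t pred-m)) odd big)
  where
  t = suc t1
  H = sumFin t h
  n = H + q + (H + q)
  j = H + q + H
  j<n : j < n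
  j<n = +-monoʳ-< (H + q) (m<m+n H 0<q)
  odd : ∀ i → toℕ i < k → ¬ 2 ∣ m i ∸ 1
  odd i i<k = subst (λ x → ¬ 2 ∣ x) (sym (trans (pred-m i) (cong (_+ (h i + h i)) (𝟙-yes (toℕ i <? k) i<k))))
                    (2∤suc-double (h i))
  size-identity : ∀ H q → suc (suc (H + q + (H + q) + (H + q + (H + q)))) ≡ suc (H + q + H) + suc (H + q + H) + (q + q)
  size-identity = solve-∀
  big : n + n < suc j + suc j + k
  big = subst (n + n <_) (trans (size-identity H q) (cong (suc j + suc j +_) (sym k≡q+q))) (<-trans (n<1+n _) (n<1+n _))

theorem1p4 : (t k : ℕ) → 2 ≤ t → 2 ≤ k → 2 ∣ k → k ≤ t →
    (m : Fin t → ℕ) →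
    (∀ i → 1 < m i) →
    (∀ i → toℕ i < k → 2 ∣ m i) →
    (∀ i → k ≤ toℕ i → ¬ (2 ∣ m i)) →
    Σ ℕ λ n →
      IsRamseyNumber t (λ i → Star (m i)) (suc n) ×
      IsStarCritical t (λ i → Star (m i)) n
        ((sumFin t m + 1 ∸ t) ∸ k / 2)
theorem1p4 t@(suc t1) k _ 2≤k (divides q k≡q*2) k≤t m 1<m even odd =
  n , subst (λ v → IsRamseyNumber t Stars (suc n) × IsStarCritical t Stars n v) (sym value)
            (stars-threshold t1 m h k q k≡q+q 0<q k≤t 0<m pred-m)
  where
  Stars : Fin t → Graph
  Stars i = Star (m i)
  h : Fin t → ℕ
  h i = (m i ∸ 1) / 2
  H n : ℕ
  H = sumFin t h
  n = H + q + (H + q)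
  k≡q+q : k ≡ q + q
  k≡q+q = trans k≡q*2 (sym (double≡*2 q))
  0<q : 0 < q
  0<q = 2≤double⇒0< (subst (2 ≤_) k≡q+q 2≤k)
  0<m : ∀ i → 0 < m i
  0<m i = <⇒≤ (1<m i)
  pred-m : ∀ i → m i ∸ 1 ≡ 𝟙 (toℕ i <? k) + (h i + h i)
  pred-m i = pred≡𝟙+double (toℕ i <? k) (0<m i) (even i) (λ i≮k → odd i (≮⇒≥ i≮k))
  value-identity : ∀ H q → H + q + (H + q) + 1 ≡ q + suc (H + q + H)
  value-identity = solve-∀
  value : (sumFin t m + 1 ∸ t) ∸ k / 2 ≡ suc (H + q + H)
  value = trans (cong₂ (λ s k → (s + 1 ∸ t) ∸ k / 2)
                       (trans (sumFin-pred t m 0<m) (cong (t +_) (sumFin-pred-decomposed t m h k q k≡q+q k≤t pred-m))) k≡q*2)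
                (star-critical-value t n q (suc (H + q + H)) (value-identity H q))
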